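{- Let $\mathcal G$ be the infinite directed graph with vertex set $\{T_i, B_i : i\ge 0\}$ and the following edges: $T_i\to B_i$ for all $i\ge0$; $B_i\to T_{i+1}$ for all $i\ge0$; $T_{i+1}\to T_i$ and $B_{i+1}\to B_i$ for all $i\ge0$; and additionally $T_j\to T_0$ and $B_j\to B_0$ for all $j\ge2$. Let $H(z)=\sum_{n\ge0}h_nz^n$, where $h_n$ is the number of directed walks with $n$ edges in $\mathcal G$ starting at $T_0$ and ending at an arbitrary vertex. Let $t=t(z)$ be the unique formal power series with $t(0)=0$ and $t(1-t)^2=z^3$. Then $$H(z)=\frac{z+z^2-zt-t^2}{ -t+z-2zt+zt^2}=1+z+z^2+2z^3+3z^4+5z^5+10z^6+\cdots.$$
   Context: Walks from $T_0$ in $\mathcal G$ encode partial (open-ended) $S$-Motzkin paths with catastrophes: flat and up steps alternate starting with flat (down steps interspersed), the path never goes below level $0$, and catastrophe steps go from any level $j\ge2$ directly to level $0$. -}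

module Defs where

open import Data.Nat using (ℕ; zero; suc; _∸_)
open import Relation.Binary.PropositionalEquality using (_≡_)
open import Data.Integer using (ℤ; +_; -_) renaming (_+_ to _+ℤ_; _*_ to _*ℤ_)
open import Data.List using (List; []; _∷_; map)
open import Data.Nat.ListAction using () renaming (sum to sumℕ)

data Vertex : Set where
  T : ℕ → Vertex
  B : ℕ → Vertex

succs : Vertex → List Vertex
succs (T zero)                = B zero ∷ []
succs (T (suc zero))          = B (suc zero) ∷ T zero ∷ []
succs (T (suc (suc i)))       = B (suc (suc i)) ∷ T (suc i) ∷ T zero ∷ []
succs (B zero)                = T (suc zero) ∷ []
succs (B (suc zero))          = T (suc (suc zero)) ∷ B zero ∷ []
succs (B (suc (suc i)))       = T (suc (suc (suc i))) ∷ B (suc i) ∷ B zero ∷ []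

walksFrom : ℕ → Vertex → ℕ
walksFrom zero    v = 1
walksFrom (suc n) v = sumℕ (map (walksFrom n) (succs v))

h : ℕ → ℕ
h n = walksFrom n (T zero)

Series : Set
Series = ℕ → ℤ

_≈ₛ_ : Series → Series → Set
f ≈ₛ g = ∀ n → f n ≡ g n

infixl 6 _⊕_ _⊖_
infixl 7 _⊛_

_⊕_ : Series → Series → Series
(f ⊕ g) n = f n +ℤ g n

⊝_ : Series → Series
(⊝ f) n = - f n

_⊖_ : Series → Series → Series
f ⊖ g = f ⊕ (⊝ g)

convUpTo : Series → Series → ℕ → ℕ → ℤ
convUpTo f g zero    n = f zero *ℤ g n
convUpTo f g (suc k) n = convUpTo f g k n +ℤ (f (suc k) *ℤ g (n ∸ suc k))

_⊛_ : Series → Series → Series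
(f ⊛ g) n = convUpTo f g n n

const : ℤ → Series
const c zero    = c
const c (suc n) = + 0

X : Series
X (suc zero) = + 1
X _          = + 0

X³ : Series
X³ (suc (suc (suc zero))) = + 1
X³ _                      = + 0

H : Series
H n = + h n

-- Let T_i and B_i be the generating functions of walks starting at T_i and B_i. Splitting off the
-- first step gives, for every level i,
--   T_i = 1 + z (B_i + T_{i-1} + [i ≥ 2] T_0),   B_i = 1 + z (T_{i+1} + B_{i-1} + [i ≥ 2] B_0).
-- Put s = t / z, a series of order ≥ 1 with s (1 - z s)² = z², and substitute it for the level
-- variable: P = Σ T_i sⁱ, Q = Σ B_i sⁱ. Multiplying the equation for P by the kernel 1 - z s and
-- eliminating Q, P′ = Σ T_{i+1} sⁱ and B_0 makes every occurrence of P cancel precisely because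
-- s (1 - z s)² = z², which leaves a linear equation for T_0 = H. The root t itself is the fixed
-- point of t ↦ z³ + t² (2 - t), a contraction for the z-adic metric.

module Submission where

open import Defs
-- Defs leaves _≈ₛ_ without a fixity; this alias binds more loosely than the series operations.
open Defs using () renaming (_≈ₛ_ to infix 4 _≈_)
open import Level using (0ℓ)
open import Data.Nat using (ℕ; zero; suc; _∸_; _+_; _<_; _≤_; z≤n; s≤s)
import Data.Nat.Properties as ℕ
open import Data.Integer using (ℤ; +_; -_; +-*-rawRing) renaming (_+_ to _+ℤ_; _*_ to _*ℤ_)
import Data.Integer.Properties as ℤ
open import Data.Integer.Tactic.RingSolver using (solve-∀)
open import Data.Maybe using (just; nothing)
open import Data.Product using (Σ; _×_; _,_)
open import Relation.Nullary using (yes; no)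
open import Relation.Binary.Definitions using (WeaklyDecidable)
open import Relation.Binary.Structures using (IsEquivalence)
open import Relation.Binary.PropositionalEquality
  using (_≡_; refl; sym; trans; cong; cong₂; module ≡-Reasoning)
import Relation.Binary.Reasoning.Setoid
open import Algebra.Bundles using (CommutativeRing)
import Algebra.Solver.Ring
open import Algebra.Solver.Ring.AlmostCommutativeRing
  using (fromCommutativeRing; _-Raw-AlmostCommutative⟶_)

tail : Series → Series
tail f n = f (suc n)

0ₛ 1ₛ : Series
0ₛ _ = + 0
1ₛ = const (+ 1)

_·_ : ℤ → Series → Series
(c · f) n = c *ℤ f n

≈-refl : ∀ {f} → f ≈ f
≈-refl _ = refl

≈-sym : ∀ {f g} → f ≈ g → g ≈ f
≈-sym p n = sym (p n)

≈-trans : ∀ {f g h} → f ≈ g → g ≈ h → f ≈ h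
≈-trans p q n = trans (p n) (q n)

⊕-cong : ∀ {f f′ g g′} → f ≈ f′ → g ≈ g′ → f ⊕ g ≈ f′ ⊕ g′
⊕-cong p q n = cong₂ _+ℤ_ (p n) (q n)

⊝-cong : ∀ {f f′} → f ≈ f′ → ⊝ f ≈ ⊝ f′
⊝-cong p n = cong -_ (p n)

convUpTo-suc : ∀ f g k m →
  convUpTo f g (suc k) m ≡ f 0 *ℤ g m +ℤ convUpTo (tail f) g k (m ∸ 1)
convUpTo-suc f g zero    m = refl
convUpTo-suc f g (suc k) m = begin
  convUpTo f g (suc k) m +ℤ f (suc (suc k)) *ℤ g (m ∸ suc (suc k))
    ≡⟨ cong (_+ℤ f (suc (suc k)) *ℤ g (m ∸ suc (suc k))) (convUpTo-suc f g k m) ⟩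
  (f 0 *ℤ g m +ℤ convUpTo (tail f) g k (m ∸ 1)) +ℤ f (suc (suc k)) *ℤ g (m ∸ suc (suc k))
    ≡⟨ ℤ.+-assoc (f 0 *ℤ g m) _ _ ⟩
  f 0 *ℤ g m +ℤ (convUpTo (tail f) g k (m ∸ 1) +ℤ f (suc (suc k)) *ℤ g (m ∸ suc (suc k)))
    ≡⟨ cong (λ i → f 0 *ℤ g m +ℤ (convUpTo (tail f) g k (m ∸ 1) +ℤ f (suc (suc k)) *ℤ g i))
            (sym (ℕ.∸-+-assoc m 1 (suc k))) ⟩
  f 0 *ℤ g m +ℤ (convUpTo (tail f) g k (m ∸ 1) +ℤ f (suc (suc k)) *ℤ g (m ∸ 1 ∸ suc k))
    ∎
  where open ≡-Reasoning

⊛-suc : ∀ f g n → (f ⊛ g) (suc n) ≡ f 0 *ℤ g (suc n) +ℤ (tail f ⊛ g) n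
⊛-suc f g n = convUpTo-suc f g n (suc n)

convUpTo-cong : ∀ {f f′ g g′} → f ≈ f′ → g ≈ g′ →
                ∀ k m → convUpTo f g k m ≡ convUpTo f′ g′ k m
convUpTo-cong p q zero    m = cong₂ _*ℤ_ (p 0) (q m)
convUpTo-cong p q (suc k) m =
  cong₂ _+ℤ_ (convUpTo-cong p q k m) (cong₂ _*ℤ_ (p (suc k)) (q (m ∸ suc k)))

⊛-cong : ∀ {f f′ g g′} → f ≈ f′ → g ≈ g′ → f ⊛ g ≈ f′ ⊛ g′
⊛-cong p q n = convUpTo-cong p q n n

⊛-zeroˡ : ∀ g → 0ₛ ⊛ g ≈ 0ₛ
⊛-zeroˡ g zero    = ℤ.*-zeroˡ (g 0)
⊛-zeroˡ g (suc n) = trans (⊛-suc 0ₛ g n) (cong₂ _+ℤ_ (ℤ.*-zeroˡ (g (suc n))) (⊛-zeroˡ g n))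

⊛-identityˡ : ∀ g → 1ₛ ⊛ g ≈ g
⊛-identityˡ g zero    = ℤ.*-identityˡ (g 0)
⊛-identityˡ g (suc n) = begin
  (1ₛ ⊛ g) (suc n)                  ≡⟨ ⊛-suc 1ₛ g n ⟩
  + 1 *ℤ g (suc n) +ℤ (0ₛ ⊛ g) n    ≡⟨ cong₂ _+ℤ_ (ℤ.*-identityˡ (g (suc n))) (⊛-zeroˡ g n) ⟩
  g (suc n) +ℤ + 0                  ≡⟨ ℤ.+-identityʳ (g (suc n)) ⟩
  g (suc n)                         ∎
  where open ≡-Reasoning

⊛-distribʳ : ∀ h f g → (f ⊕ g) ⊛ h ≈ f ⊛ h ⊕ g ⊛ h
⊛-distribʳ h f g zero    = ℤ.*-distribʳ-+ (h 0) (f 0) (g 0)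
⊛-distribʳ h f g (suc n) = begin
  ((f ⊕ g) ⊛ h) (suc n)
    ≡⟨ ⊛-suc (f ⊕ g) h n ⟩
  (f 0 +ℤ g 0) *ℤ h (suc n) +ℤ ((tail f ⊕ tail g) ⊛ h) n
    ≡⟨ cong ((f 0 +ℤ g 0) *ℤ h (suc n) +ℤ_) (⊛-distribʳ h (tail f) (tail g) n) ⟩
  (f 0 +ℤ g 0) *ℤ h (suc n) +ℤ ((tail f ⊛ h) n +ℤ (tail g ⊛ h) n)
    ≡⟨ regroup (f 0) (g 0) (h (suc n)) _ _ ⟩
  (f 0 *ℤ h (suc n) +ℤ (tail f ⊛ h) n) +ℤ (g 0 *ℤ h (suc n) +ℤ (tail g ⊛ h) n)
    ≡⟨ sym (cong₂ _+ℤ_ (⊛-suc f h n) (⊛-suc g h n)) ⟩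
  (f ⊛ h ⊕ g ⊛ h) (suc n)
    ∎
  where
  open ≡-Reasoning
  regroup : ∀ a b c d e → (a +ℤ b) *ℤ c +ℤ (d +ℤ e) ≡ (a *ℤ c +ℤ d) +ℤ (b *ℤ c +ℤ e)
  regroup = solve-∀

⊛-scalarˡ : ∀ c f g → (c · f) ⊛ g ≈ c · (f ⊛ g)
⊛-scalarˡ c f g zero    = ℤ.*-assoc c (f 0) (g 0)
⊛-scalarˡ c f g (suc n) = begin
  ((c · f) ⊛ g) (suc n)
    ≡⟨ ⊛-suc (c · f) g n ⟩
  c *ℤ f 0 *ℤ g (suc n) +ℤ ((c · tail f) ⊛ g) n
    ≡⟨ cong (c *ℤ f 0 *ℤ g (suc n) +ℤ_) (⊛-scalarˡ c (tail f) g n) ⟩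
  c *ℤ f 0 *ℤ g (suc n) +ℤ c *ℤ (tail f ⊛ g) n
    ≡⟨ factor c (f 0) (g (suc n)) _ ⟩
  c *ℤ (f 0 *ℤ g (suc n) +ℤ (tail f ⊛ g) n)
    ≡⟨ cong (c *ℤ_) (sym (⊛-suc f g n)) ⟩
  (c · (f ⊛ g)) (suc n)
    ∎
  where
  open ≡-Reasoning
  factor : ∀ a b d e → a *ℤ b *ℤ d +ℤ a *ℤ e ≡ a *ℤ (b *ℤ d +ℤ e)
  factor = solve-∀

tail-⊛ : ∀ f g → tail (f ⊛ g) ≈ f 0 · tail g ⊕ tail f ⊛ g
tail-⊛ f g = ⊛-suc f g

⊛-assoc : ∀ f g h → (f ⊛ g) ⊛ h ≈ f ⊛ (g ⊛ h)
⊛-assoc f g h zero    = ℤ.*-assoc (f 0) (g 0) (h 0)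
⊛-assoc f g h (suc n) = begin
  ((f ⊛ g) ⊛ h) (suc n)
    ≡⟨ ⊛-suc (f ⊛ g) h n ⟩
  f 0 *ℤ g 0 *ℤ h (suc n) +ℤ (tail (f ⊛ g) ⊛ h) n
    ≡⟨ cong (f 0 *ℤ g 0 *ℤ h (suc n) +ℤ_) tail-expanded ⟩
  f 0 *ℤ g 0 *ℤ h (suc n) +ℤ (f 0 *ℤ (tail g ⊛ h) n +ℤ (tail f ⊛ (g ⊛ h)) n)
    ≡⟨ regroup (f 0) (g 0) (h (suc n)) _ _ ⟩
  f 0 *ℤ (g 0 *ℤ h (suc n) +ℤ (tail g ⊛ h) n) +ℤ (tail f ⊛ (g ⊛ h)) n
    ≡⟨ cong (λ x → f 0 *ℤ x +ℤ (tail f ⊛ (g ⊛ h)) n) (sym (⊛-suc g h n)) ⟩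
  f 0 *ℤ (g ⊛ h) (suc n) +ℤ (tail f ⊛ (g ⊛ h)) n
    ≡⟨ sym (⊛-suc f (g ⊛ h) n) ⟩
  (f ⊛ (g ⊛ h)) (suc n)
    ∎
  where
  open ≡-Reasoning
  regroup : ∀ a b c d e → a *ℤ b *ℤ c +ℤ (a *ℤ d +ℤ e) ≡ a *ℤ (b *ℤ c +ℤ d) +ℤ e
  regroup = solve-∀
  tail-expanded : (tail (f ⊛ g) ⊛ h) n ≡ f 0 *ℤ (tail g ⊛ h) n +ℤ (tail f ⊛ (g ⊛ h)) n
  tail-expanded = trans (⊛-cong (tail-⊛ f g) ≈-refl n)
    (trans (⊛-distribʳ h (f 0 · tail g) (tail f ⊛ g) n)
      (cong₂ _+ℤ_ (⊛-scalarˡ (f 0) (tail g) h n) (⊛-assoc (tail f) g h n)))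

⊛-comm : ∀ f g → f ⊛ g ≈ g ⊛ f
⊛-comm f g zero          = ℤ.*-comm (f 0) (g 0)
⊛-comm f g (suc zero)    = trans (⊛-suc f g 0) (trans (swap (f 0) (g 1) (f 1) (g 0)) (sym (⊛-suc g f 0)))
  where
  swap : ∀ a b c d → a *ℤ b +ℤ c *ℤ d ≡ d *ℤ c +ℤ b *ℤ a
  swap = solve-∀
⊛-comm f g (suc (suc n)) = begin
  (f ⊛ g) (suc (suc n))
    ≡⟨ ⊛-suc f g (suc n) ⟩
  f 0 *ℤ g (suc (suc n)) +ℤ (tail f ⊛ g) (suc n)
    ≡⟨ cong (f 0 *ℤ g (suc (suc n)) +ℤ_) (trans (⊛-comm (tail f) g (suc n)) (⊛-suc g (tail f) n)) ⟩
  f 0 *ℤ g (suc (suc n)) +ℤ (g 0 *ℤ f (suc (suc n)) +ℤ (tail g ⊛ tail f) n)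
    ≡⟨ exchange (f 0) (g (suc (suc n))) (g 0) (f (suc (suc n))) _ ⟩
  g 0 *ℤ f (suc (suc n)) +ℤ (f 0 *ℤ g (suc (suc n)) +ℤ (tail g ⊛ tail f) n)
    ≡⟨ cong (g 0 *ℤ f (suc (suc n)) +ℤ_)
            (sym (trans (⊛-comm (tail g) f (suc n)) (trans (⊛-suc f (tail g) n)
                   (cong (f 0 *ℤ g (suc (suc n)) +ℤ_) (⊛-comm (tail f) (tail g) n))))) ⟩
  g 0 *ℤ f (suc (suc n)) +ℤ (tail g ⊛ f) (suc n)
    ≡⟨ sym (⊛-suc g f (suc n)) ⟩
  (g ⊛ f) (suc (suc n))
    ∎
  where
  open ≡-Reasoning
  exchange : ∀ a b c d e → a *ℤ b +ℤ (c *ℤ d +ℤ e) ≡ c *ℤ d +ℤ (a *ℤ b +ℤ e)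
  exchange = solve-∀

⊛-identityʳ : ∀ f → f ⊛ 1ₛ ≈ f
⊛-identityʳ f = ≈-trans (⊛-comm f 1ₛ) (⊛-identityˡ f)

⊛-zeroʳ : ∀ f → f ⊛ 0ₛ ≈ 0ₛ
⊛-zeroʳ f = ≈-trans (⊛-comm f 0ₛ) (⊛-zeroˡ f)

const-⊕ : ∀ a b → const (a +ℤ b) ≈ const a ⊕ const b
const-⊕ a b zero    = refl
const-⊕ a b (suc n) = refl

const-⊛ : ∀ a b → const (a *ℤ b) ≈ const a ⊛ const b
const-⊛ a b zero    = refl
const-⊛ a b (suc n) = sym (begin
  (const a ⊛ const b) (suc n)         ≡⟨ ⊛-suc (const a) (const b) n ⟩
  a *ℤ + 0 +ℤ (0ₛ ⊛ const b) n        ≡⟨ cong₂ _+ℤ_ (ℤ.*-zeroʳ a) (⊛-zeroˡ (const b) n) ⟩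
  + 0                                 ∎)
  where open ≡-Reasoning

const-⊝ : ∀ a → const (- a) ≈ ⊝ const a
const-⊝ a zero    = refl
const-⊝ a (suc n) = refl

const-0 : const (+ 0) ≈ 0ₛ
const-0 zero    = refl
const-0 (suc n) = refl

seriesCommutativeRing : CommutativeRing 0ℓ 0ℓ
seriesCommutativeRing = record
  { Carrier = Series
  ; _≈_ = _≈_
  ; _+_ = _⊕_
  ; _*_ = _⊛_
  ; -_ = ⊝_
  ; 0# = 0ₛ
  ; 1# = 1ₛ
  ; isCommutativeRing = record
    { isRing = record
      { +-isAbelianGroup = record
        { isGroup = record
          { isMonoid = record
            { isSemigroup = record
              { isMagma = record { isEquivalence = ≈-isEquivalence ; ∙-cong = ⊕-cong }
              ; assoc = λ f g h n → ℤ.+-assoc (f n) (g n) (h n)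
              }
            ; identity = (λ f n → ℤ.+-identityˡ (f n)) , (λ f n → ℤ.+-identityʳ (f n))
            }
          ; inverse = (λ f n → ℤ.+-inverseˡ (f n)) , (λ f n → ℤ.+-inverseʳ (f n))
          ; ⁻¹-cong = ⊝-cong
          }
        ; comm = λ f g n → ℤ.+-comm (f n) (g n)
        }
      ; *-cong = ⊛-cong
      ; *-assoc = ⊛-assoc
      ; *-identity = ⊛-identityˡ , ⊛-identityʳ
      ; distrib = (λ h f g → ≈-trans (⊛-comm h (f ⊕ g))
                     (≈-trans (⊛-distribʳ h f g) (⊕-cong (⊛-comm f h) (⊛-comm g h))))
                , ⊛-distribʳ
      }
    ; *-comm = ⊛-comm
    }
  }
  where
  ≈-isEquivalence : IsEquivalence _≈_
  ≈-isEquivalence = record { refl = ≈-refl ; sym = ≈-sym ; trans = ≈-trans }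

constMorphism : +-*-rawRing -Raw-AlmostCommutative⟶ fromCommutativeRing seriesCommutativeRing
constMorphism = record
  { ⟦_⟧ = const
  ; +-homo = const-⊕
  ; *-homo = const-⊛
  ; -‿homo = const-⊝
  ; 0-homo = const-0
  ; 1-homo = ≈-refl
  }

const-≟ : WeaklyDecidable (λ a b → const a ≈ const b)
const-≟ a b with a ℤ.≟ b
... | yes refl = just ≈-refl
... | no _     = nothing

module SeriesSolver =
  Algebra.Solver.Ring +-*-rawRing (fromCommutativeRing seriesCommutativeRing) constMorphism const-≟

module ≈-Reasoning = Relation.Binary.Reasoning.Setoid (CommutativeRing.setoid seriesCommutativeRing)

≈⇒⊖≈0ₛ : ∀ {f g} → f ≈ g → f ⊖ g ≈ 0ₛ
≈⇒⊖≈0ₛ p n = ℤ.i≡j⇒i-j≡0 (p n)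

⊖≈0ₛ⇒≈ : ∀ {f g} → f ⊖ g ≈ 0ₛ → f ≈ g
⊖≈0ₛ⇒≈ {f} {g} p n = ℤ.i-j≡0⇒i≡j (f n) (g n) (p n)

⊛-annihilate : ∀ c {r} → r ≈ 0ₛ → c ⊛ r ≈ 0ₛ
⊛-annihilate c r≈0 = ≈-trans (⊛-cong ≈-refl r≈0) (⊛-zeroʳ c)

infixl 6 _⊕-vanish_ _⊖-vanish_
_⊕-vanish_ : ∀ {f g} → f ≈ 0ₛ → g ≈ 0ₛ → f ⊕ g ≈ 0ₛ
(p ⊕-vanish q) n = cong₂ _+ℤ_ (p n) (q n)

_⊖-vanish_ : ∀ {f g} → f ≈ 0ₛ → g ≈ 0ₛ → f ⊖ g ≈ 0ₛ
(p ⊖-vanish q) n = cong₂ (λ x y → x +ℤ - y) (p n) (q n)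

infix 4 _≈[<_]_
_≈[<_]_ : Series → ℕ → Series → Set
f ≈[< k ] g = ∀ j → j < k → f j ≡ g j

≈[<0] : ∀ {f g} → f ≈[< 0 ] g
≈[<0] _ ()

≈[<]-trans : ∀ {k f g h} → f ≈[< k ] g → g ≈[< k ] h → f ≈[< k ] h
≈[<]-trans p q j j<k = trans (p j j<k) (q j j<k)

≈[<]-weaken : ∀ {k l f g} → k ≤ l → f ≈[< l ] g → f ≈[< k ] g
≈[<]-weaken k≤l p j j<k = p j (ℕ.<-≤-trans j<k k≤l)

⊕-cong-≈[<] : ∀ {k f f′ g g′} → f ≈[< k ] f′ → g ≈[< k ] g′ → f ⊕ g ≈[< k ] f′ ⊕ g′
⊕-cong-≈[<] p q j j<k = cong₂ _+ℤ_ (p j j<k) (q j j<k)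

⊛-congʳ-≈[<] : ∀ {k} f {g g′} → g ≈[< k ] g′ → f ⊛ g ≈[< k ] f ⊛ g′
⊛-congʳ-≈[<] f {g} {g′} p n n<k = go n
  where
  go : ∀ i → convUpTo f g i n ≡ convUpTo f g′ i n
  go zero    = cong (f 0 *ℤ_) (p n n<k)
  go (suc i) = cong₂ _+ℤ_ (go i)
    (cong (f (suc i) *ℤ_) (p (n ∸ suc i) (ℕ.≤-<-trans (ℕ.m∸n≤m n (suc i)) n<k)))

⊛-order : ∀ i {j f g} → f ≈[< i ] 0ₛ → g ≈[< j ] 0ₛ → f ⊛ g ≈[< i + j ] 0ₛ
⊛-order zero    {f = f} p q n n<j = trans (⊛-congʳ-≈[<] f q n n<j) (⊛-zeroʳ f n)
⊛-order (suc i) p q zero    _ rewrite p 0 (s≤s z≤n) = refl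
⊛-order (suc i) {f = f} {g} p q (suc n) (s≤s n<i+j) = begin
  (f ⊛ g) (suc n)                      ≡⟨ ⊛-suc f g n ⟩
  f 0 *ℤ g (suc n) +ℤ (tail f ⊛ g) n   ≡⟨ cong₂ _+ℤ_ (cong (_*ℤ g (suc n)) (p 0 (s≤s z≤n)))
                                                   (⊛-order i (λ m m<i → p (suc m) (s≤s m<i)) q n n<i+j) ⟩
  + 0 *ℤ g (suc n) +ℤ + 0              ≡⟨ ℤ.+-identityʳ _ ⟩
  + 0 *ℤ g (suc n)                     ≡⟨ ℤ.*-zeroˡ (g (suc n)) ⟩
  + 0                                  ∎
  where open ≡-Reasoning

⊖≈[<]0ₛ⇒≈[<] : ∀ {k f g} → f ⊖ g ≈[< k ] 0ₛ → f ≈[< k ] g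
⊖≈[<]0ₛ⇒≈[<] {f = f} {g} p j j<k = ℤ.i-j≡0⇒i≡j (f j) (g j) (p j j<k)

≈[<]⇒⊖≈[<]0ₛ : ∀ {k f g} → f ≈[< k ] g → f ⊖ g ≈[< k ] 0ₛ
≈[<]⇒⊖≈[<]0ₛ p j j<k = ℤ.i≡j⇒i-j≡0 (p j j<k)

X⊛-suc : ∀ f n → (X ⊛ f) (suc n) ≡ f n
X⊛-suc f n = begin
  (X ⊛ f) (suc n)                     ≡⟨ ⊛-suc X f n ⟩
  + 0 *ℤ f (suc n) +ℤ (tail X ⊛ f) n  ≡⟨ cong₂ _+ℤ_ (ℤ.*-zeroˡ (f (suc n))) (⊛-cong tail-X ≈-refl n) ⟩
  + 0 +ℤ (1ₛ ⊛ f) n                   ≡⟨ ℤ.+-identityˡ _ ⟩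
  (1ₛ ⊛ f) n                          ≡⟨ ⊛-identityˡ f n ⟩
  f n                                 ∎
  where
  open ≡-Reasoning
  tail-X : tail X ≈ 1ₛ
  tail-X zero    = refl
  tail-X (suc n) = refl

X⊛-cancel : ∀ {f g} → X ⊛ f ≈ X ⊛ g → f ≈ g
X⊛-cancel {f} {g} p n = trans (sym (X⊛-suc f n)) (trans (p (suc n)) (X⊛-suc g n))

X⊛tail : ∀ {f} → f 0 ≡ + 0 → X ⊛ tail f ≈ f
X⊛tail f0≡0 zero    = sym f0≡0
X⊛tail {f} _ (suc n) = X⊛-suc (tail f) n

X³≈X⊛[X⊛X] : X³ ≈ X ⊛ (X ⊛ X)
X³≈X⊛[X⊛X] zero    = refl
X³≈X⊛[X⊛X] (suc n) = sym (trans (X⊛-suc (X ⊛ X) n) (X⊛X≈X³∘suc n))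
  where
  X≈X³∘suc² : ∀ n → X n ≡ X³ (suc (suc n))
  X≈X³∘suc² zero          = refl
  X≈X³∘suc² (suc zero)    = refl
  X≈X³∘suc² (suc (suc n)) = refl
  X⊛X≈X³∘suc : ∀ n → (X ⊛ X) n ≡ X³ (suc n)
  X⊛X≈X³∘suc zero    = refl
  X⊛X≈X³∘suc (suc n) = trans (X⊛-suc X n) (X≈X³∘suc² n)

-- Banach's fixed point theorem for the z-adic metric on series without constant term.
module FixedPoint
  (Φ : Series → Series)
  (Φ-order : ∀ {f} → f ≈[< 1 ] 0ₛ → Φ f ≈[< 1 ] 0ₛ)
  (Φ-contract : ∀ {k f g} → f ≈[< 1 ] 0ₛ → g ≈[< 1 ] 0ₛ → f ≈[< k ] g → Φ f ≈[< suc k ] Φ g)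
  where

  approx : ℕ → Series
  approx zero    = 0ₛ
  approx (suc k) = Φ (approx k)

  approx-order : ∀ k → approx k ≈[< 1 ] 0ₛ
  approx-order zero    _ _ = refl
  approx-order (suc k) = Φ-order (approx-order k)

  approx-step : ∀ k → approx k ≈[< k ] approx (suc k)
  approx-step zero    _ ()
  approx-step (suc k) = Φ-contract (approx-order k) (approx-order (suc k)) (approx-step k)

  approx-stable : ∀ d k → approx k ≈[< k ] approx (d + k)
  approx-stable zero    k _ _ = refl
  approx-stable (suc d) k =
    ≈[<]-trans (approx-stable d k) (≈[<]-weaken (ℕ.m≤n+m k d) (approx-step (d + k)))

  fixedPoint : Series
  fixedPoint n = approx (suc n) n

  fixedPoint-≈[<] : ∀ k → fixedPoint ≈[< k ] approx k
  fixedPoint-≈[<] k j j<k = trans (approx-stable (k ∸ suc j) (suc j) j ℕ.≤-refl)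
                                  (cong (λ m → approx m j) (ℕ.m∸n+n≡m j<k))

  fixedPoint-order : fixedPoint ≈[< 1 ] 0ₛ
  fixedPoint-order = ≈[<]-trans (fixedPoint-≈[<] 1) (approx-order 1)

  fixedPoint-isFixed : Φ fixedPoint ≈ fixedPoint
  fixedPoint-isFixed n = trans
    (Φ-contract fixedPoint-order (approx-order (suc n)) (fixedPoint-≈[<] (suc n))
                n (ℕ.m≤n⇒m≤1+n (ℕ.n<1+n n)))
    (sym (fixedPoint-≈[<] (suc (suc n)) n (ℕ.m≤n⇒m≤1+n (ℕ.n<1+n n))))

cubicStep : Series → Series
cubicStep f = X³ ⊕ f ⊛ f ⊛ (const (+ 2) ⊖ f)

cubicStep-order : ∀ {f} → f ≈[< 1 ] 0ₛ → cubicStep f ≈[< 1 ] 0ₛ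
cubicStep-order f-order =
  ⊕-cong-≈[<] X³-order (⊛-order 1 (⊛-order 1 f-order ≈[<0]) ≈[<0])
  where
  X³-order : X³ ≈[< 1 ] 0ₛ
  X³-order zero    _           = refl
  X³-order (suc j) (s≤s ())

cubicStep-contract : ∀ {k f g} → f ≈[< 1 ] 0ₛ → g ≈[< 1 ] 0ₛ → f ≈[< k ] g →
                     cubicStep f ≈[< suc k ] cubicStep g
cubicStep-contract {k} {f} {g} f-order g-order f≈g = ⊖≈[<]0ₛ⇒≈[<] λ j j<1+k →
  trans (factorisation j) (⊛-order 1 factor-order (≈[<]⇒⊖≈[<]0ₛ f≈g) j j<1+k)
  where
  open SeriesSolver using (solve; _:=_; _:+_; _:*_; _:-_; con)
  factor : Series
  factor = f ⊛ (const (+ 2) ⊖ f) ⊕ g ⊛ (const (+ 2) ⊖ f ⊖ g)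
  factorisation : cubicStep f ⊖ cubicStep g ≈ factor ⊛ (f ⊖ g)
  factorisation = solve 3 (λ x³ f g →
      (x³ :+ f :* f :* (con (+ 2) :- f)) :- (x³ :+ g :* g :* (con (+ 2) :- g))
    := (f :* (con (+ 2) :- f) :+ g :* (con (+ 2) :- f :- g)) :* (f :- g)) ≈-refl X³ f g
  factor-order : factor ≈[< 1 ] 0ₛ
  factor-order = ⊕-cong-≈[<] (⊛-order 1 f-order ≈[<0]) (⊛-order 1 g-order ≈[<0])

module CubicRoot = FixedPoint cubicStep cubicStep-order cubicStep-contract

cubicRoot : Series
cubicRoot = CubicRoot.fixedPoint

cubicRoot-zero : cubicRoot zero ≡ + 0
cubicRoot-zero = CubicRoot.fixedPoint-order 0 (s≤s z≤n)

cubicRoot-cubic : cubicRoot ⊛ ((1ₛ ⊖ cubicRoot) ⊛ (1ₛ ⊖ cubicRoot)) ≈ X³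
cubicRoot-cubic = begin
  t ⊛ ((1ₛ ⊖ t) ⊛ (1ₛ ⊖ t))
    ≈⟨ solve 2 (λ x³ t → t :* ((con (+ 1) :- t) :* (con (+ 1) :- t))
                       := x³ :- (x³ :+ t :* t :* (con (+ 2) :- t) :- t)) ≈-refl X³ t ⟩
  X³ ⊖ (cubicStep t ⊖ t)
    ≈⟨ ⊕-cong (≈-refl {X³}) (⊝-cong (≈⇒⊖≈0ₛ CubicRoot.fixedPoint-isFixed)) ⟩
  X³ ⊖ 0ₛ
    ≈⟨ (λ n → ℤ.+-identityʳ (X³ n)) ⟩
  X³
    ∎
  where
  open ≈-Reasoning
  open SeriesSolver using (solve; _:=_; _:+_; _:*_; _:-_; con)
  t : Series
  t = cubicRoot

lower : (ℕ → Series) → ℕ → Series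
lower a zero    = 0ₛ
lower a (suc i) = a i

-- eval a = Σᵢ aᵢ sⁱ: as sⁱ has order at least i, the n-th coefficient of the partial sums no
-- longer changes from the n-th partial sum on.
module Substitution (s : Series) (s-order : s ≈[< 1 ] 0ₛ) where
  open SeriesSolver using (solve; _:=_; _:+_; _:*_; con)

  power : ℕ → Series
  power zero    = 1ₛ
  power (suc i) = s ⊛ power i

  power-order : ∀ i → power i ≈[< i ] 0ₛ
  power-order zero    = ≈[<0]
  power-order (suc i) = ⊛-order 1 s-order (power-order i)

  partialSum : (ℕ → Series) → ℕ → Series
  partialSum a zero    = a 0 ⊛ power 0
  partialSum a (suc N) = partialSum a N ⊕ a (suc N) ⊛ power (suc N)

  eval : (ℕ → Series) → Series
  eval a n = partialSum a n n

  partialSum-stable : ∀ a d m → partialSum a (d + m) ≈[< suc m ] partialSum a m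
  partialSum-stable a zero    m _ _     = refl
  partialSum-stable a (suc d) m j j≤m = begin
    partialSum a (d + m) j +ℤ (a (suc (d + m)) ⊛ power (suc (d + m))) j
      ≡⟨ cong (partialSum a (d + m) j +ℤ_) (⊛-order 0 ≈[<0] (power-order (suc (d + m))) j j<1+d+m) ⟩
    partialSum a (d + m) j +ℤ + 0
      ≡⟨ ℤ.+-identityʳ _ ⟩
    partialSum a (d + m) j
      ≡⟨ partialSum-stable a d m j j≤m ⟩
    partialSum a m j
      ∎
    where
    open ≡-Reasoning
    j<1+d+m : j < suc (d + m)
    j<1+d+m = ℕ.<-≤-trans j≤m (s≤s (ℕ.m≤n+m m d))

  partialSum≈[<]eval : ∀ a N → partialSum a N ≈[< suc N ] eval a
  partialSum≈[<]eval a N j (s≤s j≤N) =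
    trans (cong (λ M → partialSum a M j) (sym (ℕ.m∸n+n≡m j≤N)))
          (partialSum-stable a (N ∸ j) j j ℕ.≤-refl)

  eval-cong : ∀ {a b} → (∀ i → a i ≈ b i) → eval a ≈ eval b
  eval-cong {a} {b} a≈b n = partialSum-cong n n
    where
    partialSum-cong : ∀ N → partialSum a N ≈ partialSum b N
    partialSum-cong zero    = ⊛-cong (a≈b 0) ≈-refl
    partialSum-cong (suc N) = ⊕-cong (partialSum-cong N) (⊛-cong (a≈b (suc N)) ≈-refl)

  eval-⊕ : ∀ a b → eval (λ i → a i ⊕ b i) ≈ eval a ⊕ eval b
  eval-⊕ a b n = trans (partialSum-⊕ n n)
    (cong₂ _+ℤ_ (partialSum≈[<]eval a n n ℕ.≤-refl) (partialSum≈[<]eval b n n ℕ.≤-refl))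
    where
    partialSum-⊕ : ∀ N → partialSum (λ i → a i ⊕ b i) N ≈ partialSum a N ⊕ partialSum b N
    partialSum-⊕ zero    = ⊛-distribʳ (power 0) (a 0) (b 0)
    partialSum-⊕ (suc N) = ≈-trans (⊕-cong (partialSum-⊕ N) ≈-refl)
      (solve 5 (λ A B x y p → (A :+ B) :+ (x :+ y) :* p := (A :+ x :* p) :+ (B :+ y :* p)) ≈-refl
        (partialSum a N) (partialSum b N) (a (suc N)) (b (suc N)) (power (suc N)))

  eval-⊛ : ∀ c a → eval (λ i → c ⊛ a i) ≈ c ⊛ eval a
  eval-⊛ c a n = trans (partialSum-⊛ n n) (⊛-congʳ-≈[<] c (partialSum≈[<]eval a n) n ℕ.≤-refl)
    where
    partialSum-⊛ : ∀ N → partialSum (λ i → c ⊛ a i) N ≈ c ⊛ partialSum a N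
    partialSum-⊛ zero    = ⊛-assoc c (a 0) (power 0)
    partialSum-⊛ (suc N) = ≈-trans (⊕-cong (partialSum-⊛ N) ≈-refl)
      (solve 4 (λ c A x p → c :* A :+ c :* x :* p := c :* (A :+ x :* p)) ≈-refl
        c (partialSum a N) (a (suc N)) (power (suc N)))

  eval-unfold : ∀ a → eval a ≈ a 0 ⊕ s ⊛ eval (λ i → a (suc i))
  eval-unfold a n = begin
    eval a n
      ≡⟨ sym (partialSum≈[<]eval a (suc n) n (ℕ.m≤n⇒m≤1+n ℕ.≤-refl)) ⟩
    partialSum a (suc n) n
      ≡⟨ partialSum-unfold n n ⟩
    a 0 n +ℤ (s ⊛ partialSum (λ i → a (suc i)) n) n
      ≡⟨ cong (a 0 n +ℤ_) (⊛-congʳ-≈[<] s (partialSum≈[<]eval (λ i → a (suc i)) n) n ℕ.≤-refl) ⟩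
    a 0 n +ℤ (s ⊛ eval (λ i → a (suc i))) n
      ∎
    where
    open ≡-Reasoning
    partialSum-unfold : ∀ N → partialSum a (suc N) ≈ a 0 ⊕ s ⊛ partialSum (λ i → a (suc i)) N
    partialSum-unfold zero    =
      solve 3 (λ x y s → x :* con (+ 1) :+ y :* (s :* con (+ 1)) := x :+ s :* (y :* con (+ 1))) ≈-refl
        (a 0) (a 1) s
    partialSum-unfold (suc N) = ≈-trans (⊕-cong (partialSum-unfold N) ≈-refl)
      (solve 5 (λ x A s y p → x :+ s :* A :+ y :* (s :* p) := x :+ s :* (A :+ y :* p)) ≈-refl
        (a 0) (partialSum (λ i → a (suc i)) N) s (a (suc (suc N))) (power (suc N)))

  eval-lower : ∀ a → eval (lower a) ≈ s ⊛ eval a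
  eval-lower a n = trans (eval-unfold (lower a) n) (ℤ.+-identityˡ _)

  geometric : Series
  geometric = eval (λ _ → 1ₛ)

  geometric-unfold : geometric ≈ 1ₛ ⊕ s ⊛ geometric
  geometric-unfold = eval-unfold (λ _ → 1ₛ)

  eval-const : ∀ c → eval (λ _ → c) ≈ c ⊛ geometric
  eval-const c = ≈-trans (eval-cong (λ _ → ≈-sym (⊛-identityʳ c))) (eval-⊛ c (λ _ → 1ₛ))

  eval-levelEquation : ∀ z a b c →
    (∀ i → a i ≈ 1ₛ ⊕ z ⊛ (b i ⊕ lower a i ⊕ lower (lower (λ _ → c)) i)) →
    eval a ≈ geometric ⊕ z ⊛ (eval b ⊕ s ⊛ eval a ⊕ s ⊛ (s ⊛ (c ⊛ geometric)))
  eval-levelEquation z a b c equation = begin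
    eval a
      ≈⟨ eval-cong equation ⟩
    eval (λ i → 1ₛ ⊕ z ⊛ (b i ⊕ lower a i ⊕ c₂ i))
      ≈⟨ eval-⊕ (λ _ → 1ₛ) (λ i → z ⊛ (b i ⊕ lower a i ⊕ c₂ i)) ⟩
    geometric ⊕ eval (λ i → z ⊛ (b i ⊕ lower a i ⊕ c₂ i))
      ≈⟨ ⊕-cong (≈-refl {geometric}) (eval-⊛ z (λ i → b i ⊕ lower a i ⊕ c₂ i)) ⟩
    geometric ⊕ z ⊛ eval (λ i → b i ⊕ lower a i ⊕ c₂ i)
      ≈⟨ ⊕-cong (≈-refl {geometric}) (⊛-cong (≈-refl {z}) (≈-trans
           (eval-⊕ (λ i → b i ⊕ lower a i) c₂)
           (⊕-cong (eval-⊕ b (lower a)) (eval-lower (lower (λ _ → c)))))) ⟩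
    geometric ⊕ z ⊛ (eval b ⊕ eval (lower a) ⊕ s ⊛ eval (lower (λ _ → c)))
      ≈⟨ ⊕-cong (≈-refl {geometric}) (⊛-cong (≈-refl {z}) (⊕-cong
           (⊕-cong (≈-refl {eval b}) (eval-lower a))
           (⊛-cong (≈-refl {s}) (≈-trans (eval-lower (λ _ → c)) (⊛-cong (≈-refl {s}) (eval-const c)))))) ⟩
    geometric ⊕ z ⊛ (eval b ⊕ s ⊛ eval a ⊕ s ⊛ (s ⊛ (c ⊛ geometric)))
      ∎
    where
    open ≈-Reasoning
    c₂ : ℕ → Series
    c₂ = lower (lower (λ _ → c))

-- The certificate writes the difference of the two sides of the conclusion as a combination of
-- the hypotheses. It is the kernel method: (1 - z s) times the P-equation minus z times the
-- Q-equation loses P once z² P′ is replaced by s (1 - z s)² P′ = (1 - z s)² (P - F);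
-- multiplying by 1 - s then removes S = 1 / (1 - s).
kernel-method : ∀ {z s P Q P′ S F G} →
  P ≈ S ⊕ z ⊛ (Q ⊕ s ⊛ P ⊕ s ⊛ (s ⊛ (F ⊛ S))) →
  Q ≈ S ⊕ z ⊛ (P′ ⊕ s ⊛ Q ⊕ s ⊛ (s ⊛ (G ⊛ S))) →
  P ≈ F ⊕ s ⊛ P′ →
  S ≈ 1ₛ ⊕ s ⊛ S →
  F ≈ 1ₛ ⊕ z ⊛ G →
  s ⊛ ((1ₛ ⊖ z ⊛ s) ⊛ (1ₛ ⊖ z ⊛ s)) ≈ z ⊛ z →
  F ⊛ (1ₛ ⊖ s ⊖ const (+ 2) ⊛ z ⊛ s ⊕ z ⊛ z ⊛ s ⊛ s) ≈ 1ₛ ⊕ z ⊖ z ⊛ s ⊖ z ⊛ s ⊛ s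
kernel-method {z} {s} {P} {Q} {P′} {S} {F} {G} hP hQ hP′ hS hF hs =
  ⊖≈0ₛ⇒≈ (≈-trans certificate
    (⊛-annihilate (1ₛ ⊖ s)
       (⊛-annihilate k (≈⇒⊖≈0ₛ hP) ⊕-vanish ⊛-annihilate z (≈⇒⊖≈0ₛ hQ)
        ⊖-vanish ⊛-annihilate (k ⊛ k) (≈⇒⊖≈0ₛ hP′)
        ⊖-vanish ⊛-annihilate (z ⊛ s ⊛ s ⊛ S) (≈⇒⊖≈0ₛ hF)
        ⊖-vanish ⊛-annihilate P′ (≈⇒⊖≈0ₛ hs))
     ⊕-vanish ⊛-annihilate c (≈⇒⊖≈0ₛ hS)))
  where
  open SeriesSolver using (solve; _:=_; _:+_; _:*_; _:-_; con)
  k c : Series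
  k = 1ₛ ⊖ z ⊛ s
  c = k ⊕ z ⊖ z ⊛ s ⊛ s ⊕ z ⊛ s ⊛ s ⊛ F ⊛ (const (+ 2) ⊖ z ⊛ s)
  certificate :
    F ⊛ (1ₛ ⊖ s ⊖ const (+ 2) ⊛ z ⊛ s ⊕ z ⊛ z ⊛ s ⊛ s) ⊖ (1ₛ ⊕ z ⊖ z ⊛ s ⊖ z ⊛ s ⊛ s) ≈
    (1ₛ ⊖ s) ⊛ (k ⊛ (P ⊖ (S ⊕ z ⊛ (Q ⊕ s ⊛ P ⊕ s ⊛ (s ⊛ (F ⊛ S)))))
              ⊕ z ⊛ (Q ⊖ (S ⊕ z ⊛ (P′ ⊕ s ⊛ Q ⊕ s ⊛ (s ⊛ (G ⊛ S)))))
              ⊖ (k ⊛ k) ⊛ (P ⊖ (F ⊕ s ⊛ P′))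
              ⊖ (z ⊛ s ⊛ s ⊛ S) ⊛ (F ⊖ (1ₛ ⊕ z ⊛ G))
              ⊖ P′ ⊛ (s ⊛ (k ⊛ k) ⊖ z ⊛ z))
    ⊕ c ⊛ (S ⊖ (1ₛ ⊕ s ⊛ S))
  certificate = solve 8 (λ z s P Q P′ S F G →
      F :* (con (+ 1) :- s :- con (+ 2) :* z :* s :+ z :* z :* s :* s) :- (con (+ 1) :+ z :- z :* s :- z :* s :* s)
    := (con (+ 1) :- s) :* ((con (+ 1) :- z :* s) :* (P :- (S :+ z :* (Q :+ s :* P :+ s :* (s :* (F :* S)))))
              :+ z :* (Q :- (S :+ z :* (P′ :+ s :* Q :+ s :* (s :* (G :* S)))))
              :- ((con (+ 1) :- z :* s) :* (con (+ 1) :- z :* s)) :* (P :- (F :+ s :* P′))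
              :- (z :* s :* s :* S) :* (F :- (con (+ 1) :+ z :* G))
              :- P′ :* (s :* ((con (+ 1) :- z :* s) :* (con (+ 1) :- z :* s)) :- z :* z))
       :+ ((con (+ 1) :- z :* s) :+ z :- z :* s :* s :+ z :* s :* s :* F :* (con (+ 2) :- z :* s))
          :* (S :- (con (+ 1) :+ s :* S)))
    ≈-refl z s P Q P′ S F G

walksFromT walksFromB : ℕ → Series
walksFromT i n = + walksFrom n (T i)
walksFromB i n = + walksFrom n (B i)

levelEquation-suc : ∀ g m a b c → g m ≡ (+ a +ℤ + b) +ℤ + c →
                    + (a + (b + (c + 0))) ≡ (1ₛ ⊕ X ⊛ g) (suc m)
levelEquation-suc g m a b c gm≡a+b+c = begin
  + (a + (b + (c + 0)))          ≡⟨ cong (λ k → + (a + (b + k))) (ℕ.+-identityʳ c) ⟩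
  + (a + (b + c))                ≡⟨ cong +_ (sym (ℕ.+-assoc a b c)) ⟩
  (+ a +ℤ + b) +ℤ + c            ≡⟨ sym gm≡a+b+c ⟩
  g m                            ≡⟨ sym (ℤ.+-identityˡ (g m)) ⟩
  + 0 +ℤ g m                     ≡⟨ cong (+ 0 +ℤ_) (sym (X⊛-suc g m)) ⟩
  (1ₛ ⊕ X ⊛ g) (suc m)           ∎
  where open ≡-Reasoning

walksFromT-levelEquation : ∀ i → walksFromT i ≈
  1ₛ ⊕ X ⊛ (walksFromB i ⊕ lower walksFromT i ⊕ lower (lower (λ _ → walksFromT 0)) i)
walksFromT-levelEquation i             zero    = refl
walksFromT-levelEquation zero          (suc m) =
  levelEquation-suc (walksFromB 0 ⊕ 0ₛ ⊕ 0ₛ) m (walksFrom m (B 0)) 0 0 refl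
walksFromT-levelEquation (suc zero)    (suc m) =
  levelEquation-suc (walksFromB 1 ⊕ walksFromT 0 ⊕ 0ₛ) m (walksFrom m (B 1)) (walksFrom m (T 0)) 0 refl
walksFromT-levelEquation (suc (suc i)) (suc m) =
  levelEquation-suc (walksFromB (suc (suc i)) ⊕ walksFromT (suc i) ⊕ walksFromT 0) m
    (walksFrom m (B (suc (suc i)))) (walksFrom m (T (suc i))) (walksFrom m (T 0)) refl

walksFromB-levelEquation : ∀ i → walksFromB i ≈
  1ₛ ⊕ X ⊛ (walksFromT (suc i) ⊕ lower walksFromB i ⊕ lower (lower (λ _ → walksFromB 0)) i)
walksFromB-levelEquation i             zero    = refl
walksFromB-levelEquation zero          (suc m) =
  levelEquation-suc (walksFromT 1 ⊕ 0ₛ ⊕ 0ₛ) m (walksFrom m (T 1)) 0 0 refl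
walksFromB-levelEquation (suc zero)    (suc m) =
  levelEquation-suc (walksFromT 2 ⊕ walksFromB 0 ⊕ 0ₛ) m (walksFrom m (T 2)) (walksFrom m (B 0)) 0 refl
walksFromB-levelEquation (suc (suc i)) (suc m) =
  levelEquation-suc (walksFromT (suc (suc (suc i))) ⊕ walksFromB (suc i) ⊕ walksFromB 0) m
    (walksFrom m (T (suc (suc (suc i))))) (walksFrom m (B (suc i))) (walksFrom m (B 0)) refl

denominator numerator : Series → Series
denominator t = ((⊝ t) ⊕ X) ⊖ (const (+ 2) ⊛ X ⊛ t) ⊕ (X ⊛ t ⊛ t)
numerator   t = X ⊕ (X ⊛ X) ⊖ (X ⊛ t) ⊖ (t ⊛ t)

denominator-cong : ∀ {t u} → t ≈ u → denominator t ≈ denominator u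
denominator-cong t≈u =
  ⊕-cong (⊕-cong (⊕-cong (⊝-cong t≈u) (≈-refl {X})) (⊝-cong (⊛-cong (≈-refl {const (+ 2) ⊛ X}) t≈u)))
         (⊛-cong (⊛-cong (≈-refl {X}) t≈u) t≈u)

numerator-cong : ∀ {t u} → t ≈ u → numerator t ≈ numerator u
numerator-cong t≈u =
  ⊕-cong (⊕-cong (≈-refl {X ⊕ X ⊛ X}) (⊝-cong (⊛-cong (≈-refl {X}) t≈u))) (⊝-cong (⊛-cong t≈u t≈u))

walksFromT-zero : walksFromT 0 ≈ 1ₛ ⊕ X ⊛ walksFromB 0
walksFromT-zero = ≈-trans (walksFromT-levelEquation 0)
  (⊕-cong (≈-refl {1ₛ}) (⊛-cong (≈-refl {X}) λ n → trans (ℤ.+-identityʳ _) (ℤ.+-identityʳ _)))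

kernelRoot-order : ∀ {s} → s ⊛ ((1ₛ ⊖ X ⊛ s) ⊛ (1ₛ ⊖ X ⊛ s)) ≈ X ⊛ X → s ≈[< 1 ] 0ₛ
kernelRoot-order {s} root zero    _       = trans (sym (ℤ.*-identityʳ (s 0))) (root 0)
kernelRoot-order     root (suc j) (s≤s ())

walks-kernel : ∀ {s} → s ⊛ ((1ₛ ⊖ X ⊛ s) ⊛ (1ₛ ⊖ X ⊛ s)) ≈ X ⊛ X →
  H ⊛ (1ₛ ⊖ s ⊖ const (+ 2) ⊛ X ⊛ s ⊕ X ⊛ X ⊛ s ⊛ s) ≈ 1ₛ ⊕ X ⊖ X ⊛ s ⊖ X ⊛ s ⊛ s
walks-kernel {s} root = kernel-method
  (eval-levelEquation X walksFromT walksFromB (walksFromT 0) walksFromT-levelEquation)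
  (eval-levelEquation X walksFromB (λ i → walksFromT (suc i)) (walksFromB 0) walksFromB-levelEquation)
  (eval-unfold walksFromT)
  geometric-unfold
  walksFromT-zero
  root
  where open Substitution s (kernelRoot-order root)

tail-kernelRoot : ∀ {t} → t zero ≡ + 0 → t ⊛ ((1ₛ ⊖ t) ⊛ (1ₛ ⊖ t)) ≈ X³ →
  tail t ⊛ ((1ₛ ⊖ X ⊛ tail t) ⊛ (1ₛ ⊖ X ⊛ tail t)) ≈ X ⊛ X
tail-kernelRoot {t} t-zero t-cubic = X⊛-cancel (begin
  X ⊛ (s ⊛ ((1ₛ ⊖ X ⊛ s) ⊛ (1ₛ ⊖ X ⊛ s)))   ≈⟨ ≈-sym (⊛-assoc X s _) ⟩
  X ⊛ s ⊛ ((1ₛ ⊖ X ⊛ s) ⊛ (1ₛ ⊖ X ⊛ s))     ≈⟨ ⊛-cong X⊛s≈t (⊛-cong 1-X⊛s≈1-t 1-X⊛s≈1-t) ⟩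
  t ⊛ ((1ₛ ⊖ t) ⊛ (1ₛ ⊖ t))                 ≈⟨ t-cubic ⟩
  X³                                        ≈⟨ X³≈X⊛[X⊛X] ⟩
  X ⊛ (X ⊛ X)                               ∎)
  where
  open ≈-Reasoning
  s : Series
  s = tail t
  X⊛s≈t : X ⊛ s ≈ t
  X⊛s≈t = X⊛tail t-zero
  1-X⊛s≈1-t : 1ₛ ⊖ X ⊛ s ≈ 1ₛ ⊖ t
  1-X⊛s≈1-t = ⊕-cong (≈-refl {1ₛ}) (⊝-cong X⊛s≈t)

H-rational : ∀ t → t zero ≡ + 0 → t ⊛ ((1ₛ ⊖ t) ⊛ (1ₛ ⊖ t)) ≈ X³ →
             H ⊛ denominator t ≈ numerator t
H-rational t t-zero t-cubic = begin
  H ⊛ denominator t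
    ≈⟨ ⊛-cong (≈-refl {H}) (denominator-cong (≈-sym X⊛s≈t)) ⟩
  H ⊛ denominator (X ⊛ s)
    ≈⟨ solve 3 (λ x s h →
         h :* (:- (x :* s) :+ x :- con (+ 2) :* x :* (x :* s) :+ x :* (x :* s) :* (x :* s))
         := x :* (h :* (con (+ 1) :- s :- con (+ 2) :* x :* s :+ x :* x :* s :* s))) ≈-refl X s H ⟩
  X ⊛ (H ⊛ (1ₛ ⊖ s ⊖ const (+ 2) ⊛ X ⊛ s ⊕ X ⊛ X ⊛ s ⊛ s))
    ≈⟨ ⊛-cong (≈-refl {X}) (walks-kernel (tail-kernelRoot t-zero t-cubic)) ⟩
  X ⊛ (1ₛ ⊕ X ⊖ X ⊛ s ⊖ X ⊛ s ⊛ s)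
    ≈⟨ solve 2 (λ x s →
         x :* (con (+ 1) :+ x :- x :* s :- x :* s :* s)
         := x :+ x :* x :- x :* (x :* s) :- (x :* s) :* (x :* s)) ≈-refl X s ⟩
  numerator (X ⊛ s)
    ≈⟨ numerator-cong X⊛s≈t ⟩
  numerator t
    ∎
  where
  open ≈-Reasoning
  open SeriesSolver using (solve; _:=_; _:+_; _:*_; _:-_; :-_; con)
  s : Series
  s = tail t
  X⊛s≈t : X ⊛ s ≈ t
  X⊛s≈t = X⊛tail t-zero

mainTheorem3 :
    -- t exists: t(0) = 0 and t (1 - t)² = z³
    Σ Series (λ t → (t zero ≡ + 0) × ((t ⊛ ((const (+ 1) ⊖ t) ⊛ (const (+ 1) ⊖ t))) ≈ₛ X³))
    -- H (-t + z - 2zt + zt²) = z + z² - zt - t²  (i.e. H = numerator / denominator)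
    × ((t : Series) → t zero ≡ + 0
        → (t ⊛ ((const (+ 1) ⊖ t) ⊛ (const (+ 1) ⊖ t))) ≈ₛ X³
        → (H ⊛ (((⊝ t) ⊕ X) ⊖ (const (+ 2) ⊛ X ⊛ t) ⊕ (X ⊛ t ⊛ t)))
            ≈ₛ (X ⊕ (X ⊛ X) ⊖ (X ⊛ t) ⊖ (t ⊛ t)))
    -- first coefficients 1, 1, 1, 2, 3, 5, 10
    × (h 0 ≡ 1) × (h 1 ≡ 1) × (h 2 ≡ 1) × (h 3 ≡ 2) × (h 4 ≡ 3) × (h 5 ≡ 5) × (h 6 ≡ 10)
mainTheorem3 =
  (cubicRoot , cubicRoot-zero , cubicRoot-cubic) , H-rational ,
  refl , refl , refl , refl , refl , refl , refl
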